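{- Let $(A,B)$ be an invertible Jones pair of $n\times n$ matrices with $A$ symmetric, let $d^2=n$, and let \[ V=\begin{pmatrix} dA & -dA & B^{(-)} & B^{(-)}\\ -dA & dA & B^{(-)} & B^{(-)}\\ (B^{(-)})^T & (B^{(-)})^T & dA & -dA\\ (B^{(-)})^T & (B^{(-)})^T & -dA & dA \end{pmatrix}. \] Let $M\in\mathcal B=\{\mathcal M(F,G,H) : F\in\mathcal N_A,\ G,H\in\mathcal N_{A,B}\}$. Then for all $r,s\in\{1,\dots,2n\}$, the vector $Ve_r\circ V^{(-)}e_s\in\mathbb C^{4n}$ is an eigenvector of $M$ (here $e_1,\dots,e_{4n}$ is the standard basis of $\mathbb C^{4n}$).
   Context: All matrices are complex. $X\circ Y$ is the Schur product; $X^{(-)}$ is the Schur inverse of a matrix with no zero entries. $W$ ($n\times n$) is type-II if $W(W^{(-)})^T=nI$. For a matrix $C$, $X_C(M)=CM$, $\Delta_C(M)=C\circ M$. A Jones pair is a pair $(A,B)$ of $n\times n$ matrices with $X_A$, $\Delta_B$ invertible, $X_A\Delta_BX_A=\Delta_BX_A\Delta_B$ and $X_A\Delta_{B^T}X_A=\Delta_{B^T}X_A\Delta_{B^T}$; it is invertible if moreover $A$ has no zero entry and $B$ is invertible (equivalently $A,B$ type-II). With $e_1,\dots,e_n$ the standard basis of $\mathbb C^n$, for $P$ invertible and $Q$ without zero entries, $\mathcal N_{P,Q}$ is the set of matrices $M$ such that every $Pe_i\circ Qe_j$ is an eigenvector of $M$, and $\Theta_{P,Q}(M)$ is the matrix with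 $M(Pe_i\circ Qe_j)=\Theta_{P,Q}(M)_{ij}(Pe_i\circ Qe_j)$. For type-II $P$, $\mathcal N_P:=\mathcal N_{P,P^{(-)}}$, $\Theta_P:=\Theta_{P,P^{(-)}}$. Standing facts for the definitions: $\mathcal N_{A,B}=\mathcal N_{A,B^T}$ is closed under transposition and $\mathcal N_A=\mathcal N_{B^{(-)}}$. Pairing: for $H\in\mathcal N_{A,B}$, the matrix paired with $H$ is the unique $K$ with $K^T\in\mathcal N_{A,B^T}$ and $\Theta_{A,B}(H)=\Theta_{A,B^T}(K^T)^T$. For $F\in\mathcal N_A$, $G,H\in\mathcal N_{A,B}$, with $K$ paired with $H$, \[ \mathcal M(F,G,H)=\begin{pmatrix} \Theta_A(F)+H & \Theta_A(F)-H & \Theta_{A,B}(G) & \Theta_{A,B}(G)\\ \Theta_A(F)-H & \Theta_A(F)+H & \Theta_{A,B}(G) & \Theta_{A,B}(G)\\ \Theta_{A,B}(G^T)^T & \Theta_{A,B}(G^T)^T & \Theta_{B^{(-)}}(F)+K & \Theta_{B^{(-)}}(F)-K\\ \Theta_{A,B}(G^T)^T & \Theta_{A,B}(G^T)^T & \Theta_{B^{(-)}}(F)-K & \Theta_{B^{(-)}}(F)+K \end{pmatrix}. \] -}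

module Defs where

open import Level using (Level; _⊔_) renaming (suc to lsuc)
open import Data.Nat as ℕ using (ℕ; zero; suc)
open import Data.Fin using (Fin; zero; suc; toℕ; remQuot)
open import Data.Product using (Σ; ∃; _×_; _,_; proj₁; proj₂)
open import Relation.Nullary using (¬_)
open import Algebra.Bundles using (CommutativeRing)

-- The scalar field.  The paper works over ℂ; agda-stdlib has no ℂ, so we
-- work over an arbitrary algebraically closed field of characteristic 0.  Equality of scalars is the setoid equality ≈.
module RingOps {c ℓ} (R : CommutativeRing c ℓ) where
  open CommutativeRing R using (Carrier; 0#; 1#; _+_; _*_)

  natC : ℕ → Carrier
  natC zero    = 0#
  natC (suc k) = 1# + natC k

  pow : Carrier → ℕ → Carrier
  pow x zero    = 1#
  pow x (suc k) = x * pow x k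

  sumF : ∀ {m} → (Fin m → Carrier) → Carrier
  sumF {zero}  f = 0#
  sumF {suc m} f = f zero + sumF (λ i → f (suc i))

record ACF0 (c ℓ : Level) : Set (lsuc (c ⊔ ℓ)) where
  field
    ring : CommutativeRing c ℓ
  open CommutativeRing ring using (Carrier; 0#; 1#; _+_; _*_; _≈_)
  open RingOps ring
  field
    1≉0    : ¬ (1# ≈ 0#)
    inv    : ∀ x → ¬ (x ≈ 0#) → ∃ λ y → x * y ≈ 1#
    char0  : ∀ k → ¬ (natC (suc k) ≈ 0#)
    closed : ∀ m (a : Fin (suc m) → Carrier) →
             ∃ λ x → pow x (suc m) + sumF (λ i → a i * pow x (toℕ i)) ≈ 0#

module Mats {c ℓ} (K : ACF0 c ℓ) where
  open ACF0 K
  open CommutativeRing ring public using (Carrier; 0#; 1#; _+_; _*_; -_; _≈_)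
  open RingOps ring public

  Vec : ℕ → Set c
  Vec m = Fin m → Carrier

  Mat : ℕ → Set c
  Mat m = Fin m → Fin m → Carrier

  _≈ᵥ_ : ∀ {m} → Vec m → Vec m → Set ℓ
  u ≈ᵥ v = ∀ i → u i ≈ v i

  _≈ₘ_ : ∀ {m} → Mat m → Mat m → Set ℓ
  X ≈ₘ Y = ∀ i j → X i j ≈ Y i j

  _·_ : ∀ {m} → Mat m → Mat m → Mat m
  (X · Y) i j = sumF (λ k → X i k * Y k j)

  _⊙_ : ∀ {m} → Mat m → Mat m → Mat m
  (X ⊙ Y) i j = X i j * Y i j

  _∘ᵥ_ : ∀ {m} → Vec m → Vec m → Vec m
  (u ∘ᵥ v) i = u i * v i

  _▹_ : ∀ {m} → Mat m → Vec m → Vec m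
  (X ▹ v) i = sumF (λ k → X i k * v k)

  _ᵀ : ∀ {m} → Mat m → Mat m
  (X ᵀ) i j = X j i

  I : ∀ {m} → Mat m
  I i j with i Data.Fin.≟ j
  ... | Relation.Nullary.yes _ = 1#
  ... | Relation.Nullary.no  _ = 0#

  col : ∀ {m} → Mat m → Fin m → Vec m
  col X i k = X k i

  -- Y is the Schur inverse X^(-) of X (this forces X to have no zero entry)
  IsSchurInv : ∀ {m} → Mat m → Mat m → Set ℓ
  IsSchurInv X Y = ∀ i j → X i j * Y i j ≈ 1#

  NoZeroEntry : ∀ {m} → Mat m → Set ℓ
  NoZeroEntry X = ∀ i j → ¬ (X i j ≈ 0#)

  InvertibleMat : ∀ {m} → Mat m → Set (c ⊔ ℓ)
  InvertibleMat X = ∃ λ Y → (X · Y) ≈ₘ I × (Y · X) ≈ₘ I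

  InvertibleOp : ∀ {m} → (Mat m → Mat m) → Set (c ⊔ ℓ)
  InvertibleOp {m} L = Σ (Mat m → Mat m) λ L' →
    (∀ X → L (L' X) ≈ₘ X) × (∀ X → L' (L X) ≈ₘ X)

  X[_] : ∀ {m} → Mat m → Mat m → Mat m
  X[ C ] M = C · M

  Δ[_] : ∀ {m} → Mat m → Mat m → Mat m
  Δ[ C ] M = C ⊙ M

  IsJonesPair : ∀ {m} → Mat m → Mat m → Set (c ⊔ ℓ)
  IsJonesPair A B =
    InvertibleOp X[ A ] × InvertibleOp Δ[ B ] ×
    (∀ M → X[ A ] (Δ[ B ] (X[ A ] M)) ≈ₘ Δ[ B ] (X[ A ] (Δ[ B ] M))) ×
    (∀ M → X[ A ] (Δ[ B ᵀ ] (X[ A ] M)) ≈ₘ Δ[ B ᵀ ] (X[ A ] (Δ[ B ᵀ ] M)))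

  IsInvertibleJonesPair : ∀ {m} → Mat m → Mat m → Set (c ⊔ ℓ)
  IsInvertibleJonesPair A B = IsJonesPair A B × NoZeroEntry A × InvertibleMat B

  IsEigenvector : ∀ {m} → Mat m → Vec m → Set (c ⊔ ℓ)
  IsEigenvector M v = ¬ (∀ i → v i ≈ 0#) × ∃ λ μ → (M ▹ v) ≈ᵥ (λ i → μ * v i)

  InN : ∀ {m} → Mat m → Mat m → Mat m → Set (c ⊔ ℓ)
  InN P Q M = ∀ i j → IsEigenvector M (col P i ∘ᵥ col Q j)

  IsΘ : ∀ {m} → Mat m → Mat m → Mat m → Mat m → Set ℓ
  IsΘ P Q M T = ∀ i j →
    (M ▹ (col P i ∘ᵥ col Q j)) ≈ᵥ (λ k → T i j * (col P i ∘ᵥ col Q j) k)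

  -- 4n×4n matrices indexed by Fin (4 * n), index  b*n + i  ↔  (block b, i)
  block4 : ∀ {m} → (Fin 4 → Fin 4 → Mat m) → Mat (4 ℕ.* m)
  block4 {m} β r s with remQuot {4} m r | remQuot {4} m s
  ... | (b , i) | (b' , j) = β b b' i j

  _+ₘ_ : ∀ {m} → Mat m → Mat m → Mat m
  (X +ₘ Y) i j = X i j + Y i j

  _-ₘ_ : ∀ {m} → Mat m → Mat m → Mat m
  (X -ₘ Y) i j = X i j + (- Y i j)

  _*ₛ_ : ∀ {m} → Carrier → Mat m → Mat m
  (a *ₛ X) i j = a * X i j

  -ₘ_ : ∀ {m} → Mat m → Mat m
  (-ₘ X) i j = - X i j

  -- the matrix V of the statement, given Bm = B^(-)
  Vmat : ∀ {m} → Carrier → Mat m → Mat m → Mat (4 ℕ.* m)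
  Vmat d A Bm = block4 β
    where
    β : Fin 4 → Fin 4 → Mat _
    β zero                   zero                   = d *ₛ A
    β zero                   (suc zero)             = -ₘ (d *ₛ A)
    β zero                   (suc (suc _))          = Bm
    β (suc zero)             zero                   = -ₘ (d *ₛ A)
    β (suc zero)             (suc zero)             = d *ₛ A
    β (suc zero)             (suc (suc _))          = Bm
    β (suc (suc _))          zero                   = Bm ᵀ
    β (suc (suc _))          (suc zero)             = Bm ᵀ
    β (suc (suc zero))       (suc (suc zero))       = d *ₛ A
    β (suc (suc zero))       (suc (suc (suc _)))    = -ₘ (d *ₛ A)
    β (suc (suc (suc _)))    (suc (suc zero))       = -ₘ (d *ₛ A)
    β (suc (suc (suc _)))    (suc (suc (suc _)))    = d *ₛ A

  -- 𝓜(F,G,H) in terms of θF = Θ_A(F), θG = Θ_{A,B}(G), θGt = Θ_{A,B}(G^T),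
  -- θFB = Θ_{B^(-)}(F), and K paired with H
  Mmat : ∀ {m} → (θF H θG θGt θFB K : Mat m) → Mat (4 ℕ.* m)
  Mmat θF H θG θGt θFB K = block4 β
    where
    β : Fin 4 → Fin 4 → Mat _
    β zero                   zero                   = θF +ₘ H
    β zero                   (suc zero)             = θF -ₘ H
    β zero                   (suc (suc _))          = θG
    β (suc zero)             zero                   = θF -ₘ H
    β (suc zero)             (suc zero)             = θF +ₘ H
    β (suc zero)             (suc (suc _))          = θG
    β (suc (suc _))          zero                   = θGt ᵀ
    β (suc (suc _))          (suc zero)             = θGt ᵀ
    β (suc (suc zero))       (suc (suc zero))       = θFB +ₘ K
    β (suc (suc zero))       (suc (suc (suc _)))    = θFB -ₘ K
    β (suc (suc (suc _)))    (suc (suc zero))       = θFB -ₘ K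
    β (suc (suc (suc _)))    (suc (suc (suc _)))    = θFB +ₘ K

{-# OPTIONS --safe #-}
-- Write r = (b, i) and s = (b′, j) as block indices in the upper half. Then Ve_r ∘ V^(-)e_s has
-- blocks (σx, σx, y, y) with σ = ±1, x = Ae_i ∘ A^(-)e_j and y = B^(-)ᵀe_i ∘ Bᵀe_j (d cancels), so
-- the ±H and ±K blocks of 𝓜 cancel on it, and it is an eigenvector for 2nF_ji + 2σnG_ji as soon as
-- Θ_A(F)x = nF_ji x, Θ_{B^(-)}(F)y = nF_ji y, Θ_{A,B}(G)y = nG_ji x and Θ_{A,B}(Gᵀ)ᵀx = nG_ji y.
-- All four are instances of one exchange identity, valid whenever Qz = a e_{i₀}:
--   Θ_{P,Q}(M)(Qᵀe_p ∘ z) = a M_{p i₀} (P^(-)ᵀe_p ∘ Pᵀe_{i₀}),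
-- with z a row of A, A^(-) or B^(-), for which type II gives Qz = n e_{i₀}. That A and B are type II
-- comes from the braid relations: De_j ∘ Ae_i is an eigenvector of A for D = B and D = Bᵀ, so
-- expanding I = BB⁻¹ = B⁻¹B expresses A⁻¹ through A, B, B^(-) and the row sums of B⁻¹; symmetry of A
-- forces these row sums and the diagonal of A to be constant, which yields A⁻¹ = A^(-)ᵀ/n and then
-- BB^(-)ᵀ = nI.
module Submission where

open import Defs
open import Algebra.Bundles using (CommutativeRing)
open import Level using (_⊔_)
open import Data.Nat using (ℕ; zero; suc; _<_; _≤_) renaming (_*_ to _*ℕ_; _+_ to _+ℕ_)
open import Data.Nat.Properties using (*-comm; *-monoʳ-≤; m≤m+n; ≤⇒≯; module ≤-Reasoning)
open import Data.Fin as Fin using (Fin; zero; suc; toℕ; combine; splitAt; _↑ˡ_; _↑ʳ_)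
open import Data.Fin.Patterns using (0F; 1F; 2F; 3F)
open import Data.Fin.Properties using (splitAt-↑ˡ; splitAt-↑ʳ; combine-surjective; toℕ-combine; suc-injective)
open import Data.Product using (∃₂; _×_; _,_; proj₁; proj₂)
open import Data.Sum using (inj₁; inj₂)
open import Function using (_∘_)
open import Relation.Nullary using (¬_; yes; no; contradiction)
open import Relation.Binary.PropositionalEquality as ≡ using (_≡_; _≢_)

upper lower : Fin 2 → Fin 4
upper b = b ↑ˡ 2
lower b = 2 ↑ʳ b

upper-surjective : ∀ {n} (r : Fin (4 *ℕ n)) → toℕ r < 2 *ℕ n → ∃₂ λ b (i : Fin n) → combine (upper b) i ≡ r
upper-surjective {n} r r<2n with combine-surjective {4} {n} r
... | 0F , i , eq = 0F , i , eq
... | 1F , i , eq = 1F , i , eq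
... | suc (suc b) , i , ≡.refl = contradiction r<2n (≤⇒≯ 2n≤r)
  where
  open ≤-Reasoning
  2n≤r : 2 *ℕ n ≤ toℕ (combine {4} (suc (suc b)) i)
  2n≤r = begin
    2 *ℕ n                          ≡⟨ *-comm 2 n ⟩
    n *ℕ 2                          ≤⟨ *-monoʳ-≤ n (m≤m+n 2 (toℕ b)) ⟩
    n *ℕ (2 +ℕ toℕ b)               ≤⟨ m≤m+n _ (toℕ i) ⟩
    n *ℕ (2 +ℕ toℕ b) +ℕ toℕ i      ≡⟨ toℕ-combine (suc (suc b)) i ⟨
    toℕ (combine {4} (suc (suc b)) i) ∎

combine-elim : ∀ {m k p} (P : Fin (m *ℕ k) → Set p) → (∀ b l → P (combine b l)) → ∀ t → P t
combine-elim {m} {k} P P-combine t with b , l , ≡.refl ← combine-surjective {m} {k} t = P-combine b l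

module Theory {c ℓ} (𝕂 : ACF0 c ℓ) where
  open ACF0 𝕂 using (1≉0)
  open Mats 𝕂
  open CommutativeRing (ACF0.ring 𝕂)
    using ( setoid; refl; sym; trans; +-cong; +-congˡ; *-cong; *-congˡ; *-congʳ
          ; +-identityˡ; +-identityʳ; *-identityˡ; *-identityʳ; zeroˡ; zeroʳ; +-assoc; *-assoc
          ; +-comm; distribʳ; -‿inverseʳ; semiring; commutativeSemiring; *-commutativeSemigroup; ring )
    renaming (*-comm to *-commute)
  open import Algebra.Properties.Ring ring using (-1*x≈-x; -‿involutive)
  open import Algebra.Properties.CommutativeSemigroup *-commutativeSemigroup
    using (interchange; x∙yz≈y∙xz; x∙yz≈yx∙z; xy∙z≈y∙xz)
  open import Algebra.Properties.Semiring.Sum semiring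
    using (sum; sum-cong-≋; sum-cong-≗; ∑-comm; ∑-distrib-+; *-distribˡ-sum; *-distribʳ-sum)
  open import Algebra.Solver.Ring.NaturalCoefficients.Default commutativeSemiring
    using (solve; _:+_; _:*_; _:=_; con)
  open import Relation.Binary.Reasoning.Setoid setoid

  infixl 7 _*ᵥ_
  _*ᵥ_ : ∀ {m} → Carrier → Vec m → Vec m
  (a *ᵥ v) i = a * v i

  inverse-unique : ∀ {a b b′} → a * b ≈ 1# → a * b′ ≈ 1# → b ≈ b′
  inverse-unique {a} {b} {b′} ab≈1 ab′≈1 = begin
    b              ≈⟨ *-identityʳ b ⟨
    b * 1#         ≈⟨ *-congˡ ab′≈1 ⟨
    b * (a * b′)   ≈⟨ *-assoc b a b′ ⟨
    (b * a) * b′   ≈⟨ *-congʳ (trans (*-commute b a) ab≈1) ⟩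
    1# * b′        ≈⟨ *-identityˡ b′ ⟩
    b′             ∎

  *-cancelˡ : ∀ {a a⁻¹ x y} → a⁻¹ * a ≈ 1# → a * x ≈ a * y → x ≈ y
  *-cancelˡ {a} {a⁻¹} {x} {y} a⁻¹a≈1 ax≈ay = begin
    x              ≈⟨ *-identityˡ x ⟨
    1# * x         ≈⟨ *-congʳ a⁻¹a≈1 ⟨
    (a⁻¹ * a) * x  ≈⟨ *-assoc a⁻¹ a x ⟩
    a⁻¹ * (a * x)  ≈⟨ *-congˡ ax≈ay ⟩
    a⁻¹ * (a * y)  ≈⟨ *-assoc a⁻¹ a y ⟨
    (a⁻¹ * a) * y  ≈⟨ *-congʳ a⁻¹a≈1 ⟩
    1# * y         ≈⟨ *-identityˡ y ⟩
    y              ∎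

  ±-cancel : ∀ a h → (a + h) + (a + - h) ≈ a + a
  ±-cancel a h = begin
    (a + h) + (a + - h)   ≈⟨ solve 3 (λ a h h′ → (a :+ h) :+ (a :+ h′) := (a :+ a) :+ (h :+ h′)) refl a h (- h) ⟩
    (a + a) + (h + - h)   ≈⟨ +-congˡ (-‿inverseʳ h) ⟩
    (a + a) + 0#          ≈⟨ +-identityʳ (a + a) ⟩
    a + a                 ∎

  ∓-cancel : ∀ a h → (a + - h) + (a + h) ≈ a + a
  ∓-cancel a h = trans (+-comm (a + - h) (a + h)) (±-cancel a h)

  sumF≡sum : ∀ {m} (f : Vec m) → sumF f ≡ sum f
  sumF≡sum {zero}  f = ≡.refl
  sumF≡sum {suc m} f = ≡.cong (f zero +_) (sumF≡sum (f ∘ suc))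

  sumF-cong : ∀ {m} {f g : Vec m} → f ≈ᵥ g → sumF f ≈ sumF g
  sumF-cong {f = f} {g} f≈g rewrite sumF≡sum f | sumF≡sum g = sum-cong-≋ f≈g

  sumF-distrib-+ : ∀ {m} (f g : Vec m) → sumF (λ i → f i + g i) ≈ sumF f + sumF g
  sumF-distrib-+ f g rewrite sumF≡sum (λ i → f i + g i) | sumF≡sum f | sumF≡sum g = ∑-distrib-+ f g

  *-distribˡ-sumF : ∀ {m} x (f : Vec m) → x * sumF f ≈ sumF (λ i → x * f i)
  *-distribˡ-sumF x f rewrite sumF≡sum f | sumF≡sum (λ i → x * f i) = *-distribˡ-sum x f

  *-distribʳ-sumF : ∀ {m} x (f : Vec m) → sumF f * x ≈ sumF (λ i → f i * x)
  *-distribʳ-sumF x f rewrite sumF≡sum f | sumF≡sum (λ i → f i * x) = *-distribʳ-sum x f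

  sumF-comm : ∀ {m k} (f : Fin m → Fin k → Carrier) →
              sumF (λ i → sumF (f i)) ≈ sumF (λ j → sumF (λ i → f i j))
  sumF-comm f = begin
    sumF (λ i → sumF (f i))           ≡⟨ sumF²≡sum² f ⟩
    sum (λ i → sum (f i))             ≈⟨ ∑-comm f ⟩
    sum (λ j → sum (λ i → f i j))     ≡⟨ sumF²≡sum² (λ j i → f i j) ⟨
    sumF (λ j → sumF (λ i → f i j))   ∎
    where
    sumF²≡sum² : ∀ {m k} (g : Fin m → Vec k) → sumF (λ i → sumF (g i)) ≡ sum (λ i → sum (g i))
    sumF²≡sum² g = ≡.trans (sumF≡sum (λ i → sumF (g i))) (sum-cong-≗ (λ i → sumF≡sum (g i)))

  sumF-const : ∀ {m} a → sumF {m} (λ _ → a) ≈ natC m * a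
  sumF-const {zero}  a = sym (zeroˡ a)
  sumF-const {suc m} a = trans (+-cong (sym (*-identityˡ a)) (sumF-const {m} a)) (sym (distribʳ a 1# (natC m)))

  sumF-zero : ∀ {m} {f : Vec m} → (∀ k → f k ≈ 0#) → sumF f ≈ 0#
  sumF-zero {m} f≈0 = trans (sumF-cong f≈0) (trans (sumF-const {m} 0#) (zeroʳ (natC m)))

  sumF-single : ∀ {m} (f : Vec m) i → (∀ k → k ≢ i → f k ≈ 0#) → sumF f ≈ f i
  sumF-single f zero    f≈0 =
    trans (+-congˡ (sumF-zero (λ k → f≈0 (suc k) λ ()))) (+-identityʳ (f zero))
  sumF-single f (suc i) f≈0 =
    trans (+-cong (f≈0 zero λ ()) (sumF-single (f ∘ suc) i (λ k k≢i → f≈0 (suc k) (k≢i ∘ suc-injective))))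
          (+-identityˡ (f (suc i)))

  sumF-↑ : ∀ a {b} (f : Vec (a +ℕ b)) → sumF f ≈ sumF (λ i → f (i ↑ˡ b)) + sumF (λ j → f (a ↑ʳ j))
  sumF-↑ zero    f = sym (+-identityˡ _)
  sumF-↑ (suc a) f = trans (+-congˡ (sumF-↑ a (f ∘ suc))) (sym (+-assoc _ _ _))

  sumF-combine : ∀ m {k} (f : Vec (m *ℕ k)) → sumF f ≈ sumF {m} (λ b → sumF {k} (λ i → f (combine b i)))
  sumF-combine zero        f = refl
  sumF-combine (suc m) {k} f = trans (sumF-↑ k f) (+-congˡ (sumF-combine m (λ t → f (k ↑ʳ t))))

  I-diag : ∀ {m} (i : Fin m) → I i i ≈ 1#
  I-diag i with i Fin.≟ i
  ... | yes _   = refl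
  ... | no i≢i = contradiction ≡.refl i≢i

  I-offdiag : ∀ {m} {i j : Fin m} → i ≢ j → I i j ≈ 0#
  I-offdiag {i = i} {j} i≢j with i Fin.≟ j
  ... | yes i≡j = contradiction i≡j i≢j
  ... | no _    = refl

  I-sym : ∀ {m} (i j : Fin m) → I i j ≈ I j i
  I-sym i j with i Fin.≟ j
  ... | yes ≡.refl = sym (I-diag i)
  ... | no i≢j    = sym (I-offdiag (i≢j ∘ ≡.sym))

  diagonal-cases : ∀ {m p} (P : Fin m → Fin m → Set p) →
                   (∀ x → P x x) → (∀ {x i} → x ≢ i → P x i) → ∀ x i → P x i
  diagonal-cases P on-diagonal off-diagonal x i with x Fin.≟ i
  ... | yes ≡.refl = on-diagonal x
  ... | no x≢i    = off-diagonal x≢i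

  sumF-δʳ : ∀ {m} (f : Vec m) i → sumF (λ k → f k * I k i) ≈ f i
  sumF-δʳ f i = begin
    sumF (λ k → f k * I k i) ≈⟨ sumF-single _ i (λ k k≢i → trans (*-congˡ (I-offdiag k≢i)) (zeroʳ (f k))) ⟩
    f i * I i i              ≈⟨ *-congˡ (I-diag i) ⟩
    f i * 1#                 ≈⟨ *-identityʳ (f i) ⟩
    f i                      ∎

  sumF-δˡ : ∀ {m} i (f : Vec m) → sumF (λ k → I i k * f k) ≈ f i
  sumF-δˡ i f = trans (sumF-cong (λ k → trans (*-commute _ _) (*-congˡ (I-sym i k)))) (sumF-δʳ f i)

  ▹-congˡ : ∀ {m} {X Y : Mat m} → X ≈ₘ Y → ∀ u → (X ▹ u) ≈ᵥ (Y ▹ u)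
  ▹-congˡ X≈Y u i = sumF-cong (λ k → *-congʳ (X≈Y i k))

  ▹-congʳ : ∀ {m} (X : Mat m) {u v : Vec m} → u ≈ᵥ v → (X ▹ u) ≈ᵥ (X ▹ v)
  ▹-congʳ X u≈v i = sumF-cong (λ k → *-congˡ (u≈v k))

  ▹-*ᵥ : ∀ {m} (X : Mat m) a u → (X ▹ (a *ᵥ u)) ≈ᵥ (a *ᵥ (X ▹ u))
  ▹-*ᵥ X a u i = trans (sumF-cong (λ k → x∙yz≈y∙xz (X i k) a (u k))) (sym (*-distribˡ-sumF a (λ k → X i k * u k)))

  ▹-+ₘ : ∀ {m} (X Y : Mat m) u → ((X +ₘ Y) ▹ u) ≈ᵥ (λ i → (X ▹ u) i + (Y ▹ u) i)
  ▹-+ₘ X Y u i = trans (sumF-cong (λ k → distribʳ (u k) (X i k) (Y i k)))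
                       (sumF-distrib-+ (λ k → X i k * u k) (λ k → Y i k * u k))

  I-▹ : ∀ {m} (u : Vec m) → (I ▹ u) ≈ᵥ u
  I-▹ u i = sumF-δˡ i u

  sumF-▹-assoc : ∀ {m} (g : Vec m) (X : Mat m) (h : Vec m) →
                 sumF (λ k → sumF (λ p → g p * X p k) * h k) ≈ sumF (λ p → g p * (X ▹ h) p)
  sumF-▹-assoc g X h = begin
    sumF (λ k → sumF (λ p → g p * X p k) * h k)   ≈⟨ sumF-cong (λ k → *-distribʳ-sumF (h k) (λ p → g p * X p k)) ⟩
    sumF (λ k → sumF (λ p → (g p * X p k) * h k)) ≈⟨ sumF-comm (λ k p → (g p * X p k) * h k) ⟩
    sumF (λ p → sumF (λ k → (g p * X p k) * h k)) ≈⟨ sumF-cong (λ p → sumF-cong (λ k → *-assoc (g p) (X p k) (h k))) ⟩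
    sumF (λ p → sumF (λ k → g p * (X p k * h k))) ≈⟨ sumF-cong (λ p → *-distribˡ-sumF (g p) (λ k → X p k * h k)) ⟨
    sumF (λ p → g p * (X ▹ h) p)                  ∎

  ·-▹ : ∀ {m} (X Y : Mat m) u → ((X · Y) ▹ u) ≈ᵥ (X ▹ (Y ▹ u))
  ·-▹ X Y u i = sumF-▹-assoc (X i) Y u

  ·-assoc : ∀ {m} (X Y Z : Mat m) → ((X · Y) · Z) ≈ₘ (X · (Y · Z))
  ·-assoc X Y Z i j = ·-▹ X Y (col Z j) i

  left-inverse≈right-inverse : ∀ {m} {A L R : Mat m} → (L · A) ≈ₘ I → (A · R) ≈ₘ I → L ≈ₘ R
  left-inverse≈right-inverse {A = A} {L} {R} LA≈I AR≈I i j = begin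
    L i j             ≈⟨ sumF-δʳ (L i) j ⟨
    (L · I) i j       ≈⟨ sumF-cong (λ k → *-congˡ (AR≈I k j)) ⟨
    (L · (A · R)) i j ≈⟨ ·-assoc L A R i j ⟨
    ((L · A) · R) i j ≈⟨ sumF-cong (λ k → *-congʳ (LA≈I i k)) ⟩
    (I · R) i j       ≈⟨ sumF-δˡ i (col R j) ⟩
    R i j             ∎

  inverse-of-symmetric : ∀ {m} {A G : Mat m} → (A ᵀ) ≈ₘ A → (A · G) ≈ₘ I → (G ᵀ) ≈ₘ G × (G · A) ≈ₘ I
  inverse-of-symmetric {A = A} {G} A-sym AG≈I = Gᵀ≈G , GA≈I
    where
    GᵀA≈I : ((G ᵀ) · A) ≈ₘ I
    GᵀA≈I i j = begin
      sumF (λ k → G k i * A k j) ≈⟨ sumF-cong (λ k → trans (*-commute _ _) (*-congʳ (A-sym j k))) ⟩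
      sumF (λ k → A j k * G k i) ≈⟨ AG≈I j i ⟩
      I j i                      ≈⟨ I-sym j i ⟩
      I i j                      ∎
    Gᵀ≈G : (G ᵀ) ≈ₘ G
    Gᵀ≈G = left-inverse≈right-inverse GᵀA≈I AG≈I
    GA≈I : (G · A) ≈ₘ I
    GA≈I i j = trans (sumF-cong (λ k → *-congʳ (sym (Gᵀ≈G i k)))) (GᵀA≈I i j)

  schurInverse-sym : ∀ {m} {A Ai : Mat m} → (A ᵀ) ≈ₘ A → IsSchurInv A Ai → (Ai ᵀ) ≈ₘ Ai
  schurInverse-sym A-sym A∘Ai i j = inverse-unique (trans (*-congʳ (sym (A-sym i j))) (A∘Ai j i)) (A∘Ai i j)

  inverse-eigenvector : ∀ {m} {A G : Mat m} {w : Vec m} {a a⁻¹} → (G · A) ≈ₘ I → a * a⁻¹ ≈ 1# →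
                        (A ▹ w) ≈ᵥ (a *ᵥ w) → (G ▹ w) ≈ᵥ (a⁻¹ *ᵥ w)
  inverse-eigenvector {A = A} {G} {w} {a} {a⁻¹} GA≈I aa⁻¹≈1 Aw≈aw p = begin
    (G ▹ w) p                ≈⟨ *-identityˡ _ ⟨
    1# * (G ▹ w) p           ≈⟨ *-congʳ aa⁻¹≈1 ⟨
    (a * a⁻¹) * (G ▹ w) p    ≈⟨ xy∙z≈y∙xz a a⁻¹ _ ⟩
    a⁻¹ * (a * (G ▹ w) p)    ≈⟨ *-congˡ (▹-*ᵥ G a w p) ⟨
    a⁻¹ * (G ▹ (a *ᵥ w)) p   ≈⟨ *-congˡ (▹-congʳ G Aw≈aw p) ⟨
    a⁻¹ * (G ▹ (A ▹ w)) p    ≈⟨ *-congˡ (·-▹ G A w p) ⟨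
    a⁻¹ * ((G · A) ▹ w) p    ≈⟨ *-congˡ (▹-congˡ GA≈I w p) ⟩
    a⁻¹ * (I ▹ w) p          ≈⟨ *-congˡ (I-▹ w p) ⟩
    a⁻¹ * w p                ∎

  -- Invertible Jones pairs are type II

  Braids : ∀ {m} → Mat m → Mat m → Set (c ⊔ ℓ)
  Braids A D = ∀ M → X[ A ] (Δ[ D ] (X[ A ] M)) ≈ₘ Δ[ D ] (X[ A ] (Δ[ D ] M))

  braid-eigenvector : ∀ {m} {A D : Mat m} → Braids A D →
                      ∀ i j → (A ▹ (col D j ∘ᵥ col A i)) ≈ᵥ (D i j *ᵥ (col D j ∘ᵥ col A i))
  braid-eigenvector {A = A} {D} braids i j p = begin
    sumF (λ k → A p k * (D k j * A k i))
      ≈⟨ sumF-cong (λ k → *-congˡ (*-congˡ (sumF-δʳ (A k) i))) ⟨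
    sumF (λ k → A p k * (D k j * sumF (λ l → A k l * I l i)))
      ≈⟨ braids (λ l _ → I l i) p j ⟩
    D p j * sumF (λ k → A p k * (D k j * I k i))
      ≈⟨ *-congˡ (sumF-cong (λ k → *-assoc (A p k) (D k j) (I k i))) ⟨
    D p j * sumF (λ k → (A p k * D k j) * I k i)
      ≈⟨ *-congˡ (sumF-δʳ (λ k → A p k * D k j) i) ⟩
    D p j * (A p i * D i j)
      ≈⟨ solve 3 (λ a b c → a :* (b :* c) := c :* (a :* b)) refl (D p j) (A p i) (D i j) ⟩
    D i j * (D p j * A p i)
      ∎

  IsTypeII : ∀ {m} → Mat m → Mat m → Set ℓ
  IsTypeII {m} W W⁻ = (W · (W⁻ ᵀ)) ≈ₘ (natC m *ₛ I)

  typeII-swap : ∀ {m} {W W⁻ : Mat m} → IsTypeII W W⁻ → IsTypeII W⁻ W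
  typeII-swap {m} {W} {W⁻} typeII i j = begin
    sumF (λ l → W⁻ i l * W j l) ≈⟨ sumF-cong (λ l → *-commute (W⁻ i l) (W j l)) ⟩
    sumF (λ l → W j l * W⁻ i l) ≈⟨ typeII j i ⟩
    natC m * I j i              ≈⟨ *-congˡ (I-sym j i) ⟩
    natC m * I i j              ∎

  module JonesPairTypeII {n} {A B Ai Bm A⁻¹ B⁻¹ : Mat n}
    (A-sym : (A ᵀ) ≈ₘ A) (A∘Ai : IsSchurInv A Ai) (B∘Bm : IsSchurInv B Bm)
    (braids : Braids A B) (braidsᵀ : Braids A (B ᵀ))
    (AA⁻¹≈I : (A · A⁻¹) ≈ₘ I) (BB⁻¹≈I : (B · B⁻¹) ≈ₘ I) (B⁻¹B≈I : (B⁻¹ · B) ≈ₘ I) where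

    private
      A⁻¹-sym : (A⁻¹ ᵀ) ≈ₘ A⁻¹
      A⁻¹-sym = proj₁ (inverse-of-symmetric A-sym AA⁻¹≈I)

      A⁻¹A≈I : (A⁻¹ · A) ≈ₘ I
      A⁻¹A≈I = proj₂ (inverse-of-symmetric A-sym AA⁻¹≈I)

      A⁻¹-entry : ∀ {D Dm E : Mat n} → Braids A D → IsSchurInv D Dm → (D · E) ≈ₘ I →
                  ∀ x s i → A⁻¹ x s * A s i ≈ A x i * sumF (λ j → (Dm i j * D x j) * E j s)
      A⁻¹-entry {D} {Dm} {E} braidsD D∘Dm DE≈I x s i = begin
        A⁻¹ x s * A s i
          ≈⟨ sumF-δʳ (λ p → A⁻¹ x p * A p i) s ⟨
        sumF (λ p → (A⁻¹ x p * A p i) * I p s)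
          ≈⟨ sumF-cong (λ p → *-congˡ (DE≈I p s)) ⟨
        sumF (λ p → (A⁻¹ x p * A p i) * sumF (λ j → D p j * E j s))
          ≈⟨ sumF-cong (λ p → *-distribˡ-sumF (A⁻¹ x p * A p i) (λ j → D p j * E j s)) ⟩
        sumF (λ p → sumF (λ j → (A⁻¹ x p * A p i) * (D p j * E j s)))
          ≈⟨ sumF-comm (λ p j → (A⁻¹ x p * A p i) * (D p j * E j s)) ⟩
        sumF (λ j → sumF (λ p → (A⁻¹ x p * A p i) * (D p j * E j s)))
          ≈⟨ sumF-cong (λ j → sumF-cong (λ p →
               solve 4 (λ g a d e → (g :* a) :* (d :* e) := (g :* (d :* a)) :* e) refl
                 (A⁻¹ x p) (A p i) (D p j) (E j s))) ⟩
        sumF (λ j → sumF (λ p → (A⁻¹ x p * (D p j * A p i)) * E j s))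
          ≈⟨ sumF-cong (λ j → *-distribʳ-sumF (E j s) (λ p → A⁻¹ x p * (D p j * A p i))) ⟨
        sumF (λ j → (A⁻¹ ▹ (col D j ∘ᵥ col A i)) x * E j s)
          ≈⟨ sumF-cong (λ j → *-congʳ (A⁻¹-eigenvector i j x)) ⟩
        sumF (λ j → (Dm i j * (D x j * A x i)) * E j s)
          ≈⟨ sumF-cong (λ j →
               solve 4 (λ m d a e → (m :* (d :* a)) :* e := a :* ((m :* d) :* e)) refl
                 (Dm i j) (D x j) (A x i) (E j s)) ⟩
        sumF (λ j → A x i * ((Dm i j * D x j) * E j s))
          ≈⟨ *-distribˡ-sumF (A x i) (λ j → (Dm i j * D x j) * E j s) ⟨
        A x i * sumF (λ j → (Dm i j * D x j) * E j s)
          ∎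
        where
        A⁻¹-eigenvector : ∀ i j → (A⁻¹ ▹ (col D j ∘ᵥ col A i)) ≈ᵥ (Dm i j *ᵥ (col D j ∘ᵥ col A i))
        A⁻¹-eigenvector i j = inverse-eigenvector A⁻¹A≈I (D∘Dm i j) (braid-eigenvector braidsD i j)

      κ : Fin n → Carrier
      κ s = sumF (λ j → B⁻¹ s j)

      A⁻¹-diag-entry : ∀ x s → A⁻¹ x s * A s x ≈ A x x * κ s
      A⁻¹-diag-entry x s = trans (A⁻¹-entry braidsᵀ (λ i j → B∘Bm j i) BᵀB⁻¹ᵀ≈I x s x) (*-congˡ (sumF-cong λ j →
        trans (*-congʳ (trans (*-commute (Bm j x) (B j x)) (B∘Bm j x))) (*-identityˡ (B⁻¹ s j))))
        where
        BᵀB⁻¹ᵀ≈I : ((B ᵀ) · (B⁻¹ ᵀ)) ≈ₘ I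
        BᵀB⁻¹ᵀ≈I p q = trans (sumF-cong (λ j → *-commute (B j p) (B⁻¹ q j))) (trans (B⁻¹B≈I q p) (I-sym q p))

      Axx*Σκ≈1 : ∀ x → A x x * sumF κ ≈ 1#
      Axx*Σκ≈1 x = begin
        A x x * sumF κ              ≈⟨ *-distribˡ-sumF (A x x) κ ⟩
        sumF (λ s → A x x * κ s)    ≈⟨ sumF-cong (A⁻¹-diag-entry x) ⟨
        sumF (λ s → A⁻¹ x s * A s x) ≈⟨ A⁻¹A≈I x x ⟩
        I x x                       ≈⟨ I-diag x ⟩
        1#                          ∎

      κ-const : ∀ s x → κ s ≈ κ x
      κ-const s x = begin
        κ s                          ≈⟨ *-identityˡ (κ s) ⟨
        1# * κ s                     ≈⟨ *-congʳ (Axx*Σκ≈1 x) ⟨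
        (A x x * sumF κ) * κ s       ≈⟨ xy∙z≈y∙xz (A x x) (sumF κ) (κ s) ⟩
        sumF κ * (A x x * κ s)       ≈⟨ *-congˡ (trans (sym (A⁻¹-diag-entry x s))
                                          (trans (*-cong (A⁻¹-sym s x) (A-sym x s)) (A⁻¹-diag-entry s x))) ⟩
        sumF κ * (A s s * κ x)       ≈⟨ xy∙z≈y∙xz (A s s) (sumF κ) (κ x) ⟨
        (A s s * sumF κ) * κ x       ≈⟨ *-congʳ (Axx*Σκ≈1 s) ⟩
        1# * κ x                     ≈⟨ *-identityˡ (κ x) ⟩
        κ x                          ∎

      ν : Fin n → Carrier
      ν x = A x x * κ x

      ν*n≈1 : ∀ x → ν x * natC n ≈ 1#
      ν*n≈1 x = begin
        (A x x * κ x) * natC n  ≈⟨ *-assoc (A x x) (κ x) (natC n) ⟩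
        A x x * (κ x * natC n)  ≈⟨ *-congˡ (*-commute (κ x) (natC n)) ⟩
        A x x * (natC n * κ x)  ≈⟨ *-congˡ (trans (sumF-cong (λ s → κ-const s x)) (sumF-const {n} (κ x))) ⟨
        A x x * sumF κ          ≈⟨ Axx*Σκ≈1 x ⟩
        1#                      ∎

      A⁻¹≈νAi : ∀ s j → A⁻¹ s j ≈ ν j * Ai j s
      A⁻¹≈νAi s j = begin
        A⁻¹ s j                        ≈⟨ A⁻¹-sym j s ⟩
        A⁻¹ j s                        ≈⟨ *-identityʳ (A⁻¹ j s) ⟨
        A⁻¹ j s * 1#                   ≈⟨ *-congˡ (A∘Ai s j) ⟨
        A⁻¹ j s * (A s j * Ai s j)     ≈⟨ *-assoc (A⁻¹ j s) (A s j) (Ai s j) ⟨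
        (A⁻¹ j s * A s j) * Ai s j     ≈⟨ *-congʳ (A⁻¹-diag-entry j s) ⟩
        (A j j * κ s) * Ai s j         ≈⟨ *-cong (*-congˡ (κ-const s j)) (schurInverse-sym A-sym A∘Ai j s) ⟩
        ν j * Ai j s                   ∎

      I≈Aκ*BBmᵀ : ∀ x i → I x i ≈ (A x i * κ x) * (B · (Bm ᵀ)) x i
      I≈Aκ*BBmᵀ x i = begin
        I x i
          ≈⟨ A⁻¹A≈I x i ⟨
        sumF (λ s → A⁻¹ x s * A s i)
          ≈⟨ sumF-cong (λ s → A⁻¹-entry braids B∘Bm BB⁻¹≈I x s i) ⟩
        sumF (λ s → A x i * sumF (λ j → (Bm i j * B x j) * B⁻¹ j s))
          ≈⟨ *-distribˡ-sumF (A x i) (λ s → sumF (λ j → (Bm i j * B x j) * B⁻¹ j s)) ⟨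
        A x i * sumF (λ s → sumF (λ j → (Bm i j * B x j) * B⁻¹ j s))
          ≈⟨ *-congˡ (sumF-comm (λ s j → (Bm i j * B x j) * B⁻¹ j s)) ⟩
        A x i * sumF (λ j → sumF (λ s → (Bm i j * B x j) * B⁻¹ j s))
          ≈⟨ *-congˡ (sumF-cong (λ j → *-distribˡ-sumF (Bm i j * B x j) (λ s → B⁻¹ j s))) ⟨
        A x i * sumF (λ j → (Bm i j * B x j) * κ j)
          ≈⟨ *-congˡ (sumF-cong (λ j → trans (*-cong (*-commute (Bm i j) (B x j)) (κ-const j x))
                                             (*-commute (B x j * Bm i j) (κ x)))) ⟩
        A x i * sumF (λ j → κ x * (B x j * Bm i j))
          ≈⟨ *-congˡ (*-distribˡ-sumF (κ x) (λ j → B x j * Bm i j)) ⟨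
        A x i * (κ x * (B · (Bm ᵀ)) x i)
          ≈⟨ *-assoc (A x i) (κ x) _ ⟨
        (A x i * κ x) * (B · (Bm ᵀ)) x i
          ∎

    typeII-A : IsTypeII A Ai
    typeII-A i j = sym (begin
      natC n * I i j                                   ≈⟨ *-congˡ (AA⁻¹≈I i j) ⟨
      natC n * sumF (λ s → A i s * A⁻¹ s j)            ≈⟨ *-congˡ (sumF-cong (λ s → *-congˡ (A⁻¹≈νAi s j))) ⟩
      natC n * sumF (λ s → A i s * (ν j * Ai j s))     ≈⟨ *-congˡ (sumF-cong (λ s → x∙yz≈y∙xz (A i s) (ν j) (Ai j s))) ⟩
      natC n * sumF (λ s → ν j * (A i s * Ai j s))     ≈⟨ *-congˡ (*-distribˡ-sumF (ν j) (λ s → A i s * Ai j s)) ⟨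
      natC n * (ν j * (A · (Ai ᵀ)) i j)                ≈⟨ x∙yz≈yx∙z (natC n) (ν j) _ ⟩
      (ν j * natC n) * (A · (Ai ᵀ)) i j                ≈⟨ *-congʳ (ν*n≈1 j) ⟩
      1# * (A · (Ai ᵀ)) i j                            ≈⟨ *-identityˡ _ ⟩
      (A · (Ai ᵀ)) i j                                 ∎)

    typeII-B : IsTypeII B Bm
    typeII-B = diagonal-cases (λ x i → (B · (Bm ᵀ)) x i ≈ natC n * I x i) on-diagonal off-diagonal
      where
      on-diagonal : ∀ x → (B · (Bm ᵀ)) x x ≈ natC n * I x x
      on-diagonal x = begin
        sumF (λ j → B x j * Bm x j) ≈⟨ sumF-cong (B∘Bm x) ⟩
        sumF {n} (λ _ → 1#)         ≈⟨ sumF-const {n} 1# ⟩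
        natC n * 1#                 ≈⟨ *-congˡ (I-diag x) ⟨
        natC n * I x x              ∎
      off-diagonal : ∀ {x i} → x ≢ i → (B · (Bm ᵀ)) x i ≈ natC n * I x i
      off-diagonal {x} {i} x≢i = *-cancelˡ a⁻¹a≈1 (begin
        (A x i * κ x) * (B · (Bm ᵀ)) x i ≈⟨ I≈Aκ*BBmᵀ x i ⟨
        I x i                            ≈⟨ I-offdiag x≢i ⟩
        0#                               ≈⟨ trans (*-congˡ (trans (*-congˡ (I-offdiag x≢i)) (zeroʳ _))) (zeroʳ _) ⟨
        (A x i * κ x) * (natC n * I x i) ∎)
        where
        a⁻¹a≈1 : (Ai x i * (A x x * natC n)) * (A x i * κ x) ≈ 1#
        a⁻¹a≈1 = begin
          (Ai x i * (A x x * natC n)) * (A x i * κ x)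
            ≈⟨ solve 5 (λ ai axx nn a k → (ai :* (axx :* nn)) :* (a :* k) := (a :* ai) :* ((axx :* k) :* nn)) refl
                 (Ai x i) (A x x) (natC n) (A x i) (κ x) ⟩
          (A x i * Ai x i) * (ν x * natC n) ≈⟨ *-cong (A∘Ai x i) (ν*n≈1 x) ⟩
          1# * 1#                           ≈⟨ *-identityˡ 1# ⟩
          1#                                ∎

  invertibleJonesPair⇒typeII : ∀ {n} {A B Ai Bm : Mat n} → IsInvertibleJonesPair A B → (A ᵀ) ≈ₘ A →
                               IsSchurInv A Ai → IsSchurInv B Bm → IsTypeII A Ai × IsTypeII B Bm
  invertibleJonesPair⇒typeII ((X[A]-invertible , _ , braids , braidsᵀ) , _ , (B⁻¹ , BB⁻¹≈I , B⁻¹B≈I))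
                             A-sym A∘Ai B∘Bm =
    typeII-A , typeII-B
    where
    open JonesPairTypeII A-sym A∘Ai B∘Bm braids braidsᵀ (proj₁ (proj₂ X[A]-invertible) I) BB⁻¹≈I B⁻¹B≈I

  -- Eigenvalues of Θ-images

  IsΘ-swap : ∀ {m} {P Q M T : Mat m} → IsΘ P Q M T → IsΘ Q P M (T ᵀ)
  IsΘ-swap {P = P} {Q} {M} {T} Θ i j k = begin
    (M ▹ (col Q i ∘ᵥ col P j)) k   ≈⟨ ▹-congʳ M (λ l → *-commute (Q l i) (P l j)) k ⟩
    (M ▹ (col P j ∘ᵥ col Q i)) k   ≈⟨ Θ j i k ⟩
    T j i * (P k j * Q k i)        ≈⟨ *-congˡ (*-commute (P k j) (Q k i)) ⟩
    T j i * (Q k i * P k j)        ∎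

  -- T_kl Q_pl = P⁻_pk (M(Pe_k ∘ Qe_l))_p, and summing against z_l turns Qe_l into (Qz)_m = a δ_{m i₀}.
  Θ-exchange : ∀ {m} {P P⁻ Q M T : Mat m} {z : Vec m} {a : Carrier} {i₀ : Fin m} →
               IsΘ P Q M T → IsSchurInv P P⁻ → (Q ▹ z) ≈ᵥ (a *ᵥ col I i₀) →
               ∀ p → (T ▹ (Q p ∘ᵥ z)) ≈ᵥ ((a * M p i₀) *ᵥ (P⁻ p ∘ᵥ P i₀))
  Θ-exchange {P = P} {P⁻} {Q} {M} {T} {z} {a} {i₀} Θ P∘P⁻ Qz≈ae p k = begin
    sumF (λ l → T k l * (Q p l * z l))
      ≈⟨ sumF-cong (λ l → trans (sym (*-assoc (T k l) (Q p l) (z l))) (*-congʳ (TQ≈P⁻MPQ l))) ⟩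
    sumF (λ l → (P⁻ p k * sumF (λ m → M p m * (P m k * Q m l))) * z l)
      ≈⟨ sumF-cong (λ l → trans (*-assoc (P⁻ p k) _ (z l))
                           (*-congˡ (*-congʳ (sumF-cong (λ m → sym (*-assoc (M p m) (P m k) (Q m l))))))) ⟩
    sumF (λ l → P⁻ p k * (sumF (λ m → (M p m * P m k) * Q m l) * z l))
      ≈⟨ *-distribˡ-sumF (P⁻ p k) (λ l → sumF (λ m → (M p m * P m k) * Q m l) * z l) ⟨
    P⁻ p k * sumF (λ l → sumF (λ m → (M p m * P m k) * Q m l) * z l)
      ≈⟨ *-congˡ (sumF-▹-assoc (λ m → M p m * P m k) Q z) ⟩
    P⁻ p k * sumF (λ m → (M p m * P m k) * (Q ▹ z) m)
      ≈⟨ *-congˡ (sumF-cong (λ m → trans (*-congˡ (Qz≈ae m)) (x∙yz≈yx∙z (M p m * P m k) a (I m i₀)))) ⟩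
    P⁻ p k * sumF (λ m → (a * (M p m * P m k)) * I m i₀)
      ≈⟨ *-congˡ (sumF-δʳ (λ m → a * (M p m * P m k)) i₀) ⟩
    P⁻ p k * (a * (M p i₀ * P i₀ k))
      ≈⟨ solve 4 (λ q a m r → q :* (a :* (m :* r)) := (a :* m) :* (q :* r)) refl (P⁻ p k) a (M p i₀) (P i₀ k) ⟩
    (a * M p i₀) * (P⁻ p k * P i₀ k)
      ∎
    where
    TQ≈P⁻MPQ : ∀ l → T k l * Q p l ≈ P⁻ p k * sumF (λ m → M p m * (P m k * Q m l))
    TQ≈P⁻MPQ l = begin
      T k l * Q p l                    ≈⟨ *-identityˡ (T k l * Q p l) ⟨
      1# * (T k l * Q p l)             ≈⟨ *-congʳ (trans (*-commute (P⁻ p k) (P p k)) (P∘P⁻ p k)) ⟨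
      (P⁻ p k * P p k) * (T k l * Q p l) ≈⟨ solve 4 (λ q r t u → (q :* r) :* (t :* u) := q :* (t :* (r :* u))) refl
                                              (P⁻ p k) (P p k) (T k l) (Q p l) ⟩
      P⁻ p k * (T k l * (P p k * Q p l)) ≈⟨ *-congˡ (Θ k l p) ⟨
      P⁻ p k * sumF (λ m → M p m * (P m k * Q m l)) ∎

  module ColumnProducts {n} {A B Ai Bm : Mat n}
    (A-sym : (A ᵀ) ≈ₘ A) (A∘Ai : IsSchurInv A Ai) (B∘Bm : IsSchurInv B Bm)
    (typeII-A : IsTypeII A Ai) (typeII-B : IsTypeII B Bm) (i j : Fin n) where

    x y : Vec n
    x = col A i ∘ᵥ col Ai j
    y = Bm i ∘ᵥ B j

    private
      x≈rows : x ≈ᵥ (A i ∘ᵥ Ai j)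
      x≈rows l = *-cong (A-sym i l) (schurInverse-sym A-sym A∘Ai j l)

      x≈rowsᵀ : x ≈ᵥ (Ai j ∘ᵥ A i)
      x≈rowsᵀ l = trans (x≈rows l) (*-commute (A i l) (Ai j l))

      y≈rowsᵀ : y ≈ᵥ (B j ∘ᵥ Bm i)
      y≈rowsᵀ l = *-commute (Bm i l) (B j l)

      Bm∘B : IsSchurInv Bm B
      Bm∘B k l = trans (*-commute (Bm k l) (B k l)) (B∘Bm k l)

    θF-eigen : ∀ {F θF} → IsΘ A Ai F θF → (θF ▹ x) ≈ᵥ ((natC n * F j i) *ᵥ x)
    θF-eigen {θF = θF} Θ k = trans (▹-congʳ θF x≈rowsᵀ k)
      (trans (Θ-exchange Θ A∘Ai (λ m → typeII-swap typeII-A m i) j k) (*-congˡ (sym (x≈rowsᵀ k))))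

    θFB-eigen : ∀ {F θFB} → IsΘ Bm B F θFB → (θFB ▹ y) ≈ᵥ ((natC n * F j i) *ᵥ y)
    θFB-eigen {θFB = θFB} Θ k = trans (▹-congʳ θFB y≈rowsᵀ k)
      (trans (Θ-exchange Θ Bm∘B (λ m → typeII-B m i) j k) (*-congˡ (sym (y≈rowsᵀ k))))

    θG-eigen : ∀ {G θG} → IsΘ A B G θG → (θG ▹ y) ≈ᵥ ((natC n * G j i) *ᵥ x)
    θG-eigen {θG = θG} Θ k = trans (▹-congʳ θG y≈rowsᵀ k)
      (trans (Θ-exchange Θ A∘Ai (λ m → typeII-B m i) j k) (*-congˡ (sym (x≈rowsᵀ k))))

    θGᵀ-eigen : ∀ {G θGᵀ} → IsΘ A B (G ᵀ) θGᵀ → ((θGᵀ ᵀ) ▹ x) ≈ᵥ ((natC n * G j i) *ᵥ y)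
    θGᵀ-eigen {θGᵀ = θGᵀ} Θ k = trans (▹-congʳ (θGᵀ ᵀ) x≈rows k)
      (Θ-exchange (IsΘ-swap Θ) B∘Bm (λ m → typeII-A m j) i k)

  -- Block matrices

  block : ∀ {m} → Mat (4 *ℕ m) → Fin 4 → Fin 4 → Mat m
  block X b b′ l l′ = X (combine b l) (combine b′ l′)

  ▹-upper-lower : ∀ {m} (X : Mat (4 *ℕ m)) {w : Vec (4 *ℕ m)} {u u′ : Vec m} →
                  (∀ b l → w (combine (upper b) l) ≈ u l) → (∀ b l → w (combine (lower b) l) ≈ u′ l) →
                  ∀ b l → (X ▹ w) (combine b l) ≈
                          ((block X b 0F +ₘ block X b 1F) ▹ u) l + ((block X b 2F +ₘ block X b 3F) ▹ u′) l
  ▹-upper-lower {m} X {w} {u} {u′} w-upper w-lower b l = begin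
    (X ▹ w) (combine b l)
      ≈⟨ sumF-combine 4 {m} (λ t → X (combine b l) t * w t) ⟩
    s 0F + (s 1F + (s 2F + (s 3F + 0#)))
      ≈⟨ +-cong (on 0F u (w-upper 0F)) (+-cong (on 1F u (w-upper 1F))
           (+-cong (on 2F u′ (w-lower 0F)) (+-cong (on 3F u′ (w-lower 1F)) refl))) ⟩
    Xu 0F + (Xu 1F + (Xu′ 2F + (Xu′ 3F + 0#)))
      ≈⟨ solve 4 (λ p q r t → p :+ (q :+ (r :+ (t :+ con 0))) := (p :+ q) :+ (r :+ t)) refl
           (Xu 0F) (Xu 1F) (Xu′ 2F) (Xu′ 3F) ⟩
    (Xu 0F + Xu 1F) + (Xu′ 2F + Xu′ 3F)
      ≈⟨ +-cong (▹-+ₘ (block X b 0F) (block X b 1F) u l) (▹-+ₘ (block X b 2F) (block X b 3F) u′ l) ⟨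
    ((block X b 0F +ₘ block X b 1F) ▹ u) l + ((block X b 2F +ₘ block X b 3F) ▹ u′) l
      ∎
    where
    s : Fin 4 → Carrier
    s b′ = sumF (λ l′ → block X b b′ l l′ * w (combine b′ l′))
    Xu Xu′ : Fin 4 → Carrier
    Xu  b′ = (block X b b′ ▹ u) l
    Xu′ b′ = (block X b b′ ▹ u′) l
    on : ∀ b′ v → (∀ l′ → w (combine b′ l′) ≈ v l′) → s b′ ≈ (block X b b′ ▹ v) l
    on b′ v w≈v = sumF-cong (λ l′ → *-congˡ (w≈v l′))

  sign : Fin 2 → Carrier
  sign 0F = 1#
  sign 1F = - 1#

  sign² : ∀ b → sign b * sign b ≈ 1#
  sign² 0F = *-identityˡ 1#
  sign² 1F = trans (-1*x≈-x (- 1#)) (-‿involutive 1#)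

  sign-pair² : ∀ b b′ → (sign b * sign b′) * (sign b * sign b′) ≈ 1#
  sign-pair² b b′ = trans (interchange (sign b) (sign b′) (sign b) (sign b′))
                          (trans (*-cong (sign² b) (sign² b′)) (*-identityˡ 1#))

  scaled-quotient : ∀ {p q q⁻¹ e e′ t a a′ a′⁻¹} → p ≈ e * (t * a) → q ≈ e′ * (t * a′) → q * q⁻¹ ≈ 1# →
                    a′ * a′⁻¹ ≈ 1# → e′ * e′ ≈ 1# → p * q⁻¹ ≈ (e * e′) * (a * a′⁻¹)
  scaled-quotient {p} {q} {q⁻¹} {e} {e′} {t} {a} {a′} {a′⁻¹} p≈eta q≈e′ta′ qq⁻¹≈1 a′a′⁻¹≈1 e′e′≈1 = begin
    p * q⁻¹                                            ≈⟨ *-congʳ p≈eta ⟩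
    (e * (t * a)) * q⁻¹                                ≈⟨ *-identityʳ _ ⟨
    ((e * (t * a)) * q⁻¹) * 1#                         ≈⟨ *-congˡ (trans (*-cong e′e′≈1 a′a′⁻¹≈1) (*-identityˡ 1#)) ⟨
    ((e * (t * a)) * q⁻¹) * ((e′ * e′) * (a′ * a′⁻¹))  ≈⟨ solve 7 (λ e t a q⁻¹ e′ a′ a′⁻¹ →
                                                            ((e :* (t :* a)) :* q⁻¹) :* ((e′ :* e′) :* (a′ :* a′⁻¹))
                                                            := ((e :* e′) :* (a :* a′⁻¹)) :* ((e′ :* (t :* a′)) :* q⁻¹))
                                                          refl e t a q⁻¹ e′ a′ a′⁻¹ ⟩
    ((e * e′) * (a * a′⁻¹)) * ((e′ * (t * a′)) * q⁻¹)  ≈⟨ *-congˡ (trans (*-congʳ (sym q≈e′ta′)) qq⁻¹≈1) ⟩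
    ((e * e′) * (a * a′⁻¹)) * 1#                       ≈⟨ *-identityʳ _ ⟩
    (e * e′) * (a * a′⁻¹)                              ∎

  module _ {n : ℕ} where
    -- Mmat and Vmat are block4 of a table local to Defs, so their blocks are exposed by rewriting
    -- the splitAt steps of remQuot one block at a time.
    private
      split₀ : ∀ k (l : Fin n) → splitAt n (combine {suc k} zero l) ≡ inj₁ l
      split₀ k l = splitAt-↑ˡ n l (k *ℕ n)

      split₊ : ∀ k b (l : Fin n) → splitAt n (combine {suc k} (suc b) l) ≡ inj₂ (combine b l)
      split₊ k b l = splitAt-↑ʳ n (k *ℕ n) (combine b l)

    module _ (θF H θG θGt θFB K : Mat n) where
      private
        𝓜 : Mat (4 *ℕ n)
        𝓜 = Mmat θF H θG θGt θFB K

      Mmat-upper-left : ∀ b → (block 𝓜 (upper b) 0F +ₘ block 𝓜 (upper b) 1F) ≈ₘ (θF +ₘ θF)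
      Mmat-upper-left 0F l l′ rewrite split₀ 3 l | split₀ 3 l′ | split₊ 3 0F l′ | split₀ 2 l′ =
        ±-cancel (θF l l′) (H l l′)
      Mmat-upper-left 1F l l′ rewrite split₊ 3 0F l | split₀ 2 l | split₀ 3 l′ | split₊ 3 0F l′ | split₀ 2 l′ =
        ∓-cancel (θF l l′) (H l l′)

      Mmat-upper-right : ∀ b → (block 𝓜 (upper b) 2F +ₘ block 𝓜 (upper b) 3F) ≈ₘ (θG +ₘ θG)
      Mmat-upper-right 0F l l′
        rewrite split₀ 3 l
              | split₊ 3 1F l′ | split₊ 2 0F l′ | split₀ 1 l′
              | split₊ 3 2F l′ | split₊ 2 1F l′ | split₊ 1 0F l′ | split₀ 0 l′ = refl
      Mmat-upper-right 1F l l′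
        rewrite split₊ 3 0F l | split₀ 2 l
              | split₊ 3 1F l′ | split₊ 2 0F l′ | split₀ 1 l′
              | split₊ 3 2F l′ | split₊ 2 1F l′ | split₊ 1 0F l′ | split₀ 0 l′ = refl

      Mmat-lower-left : ∀ b → (block 𝓜 (lower b) 0F +ₘ block 𝓜 (lower b) 1F) ≈ₘ ((θGt ᵀ) +ₘ (θGt ᵀ))
      Mmat-lower-left 0F l l′
        rewrite split₊ 3 1F l | split₊ 2 0F l | split₀ 1 l
              | split₀ 3 l′ | split₊ 3 0F l′ | split₀ 2 l′ = refl
      Mmat-lower-left 1F l l′
        rewrite split₊ 3 2F l | split₊ 2 1F l | split₊ 1 0F l | split₀ 0 l
              | split₀ 3 l′ | split₊ 3 0F l′ | split₀ 2 l′ = refl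

      Mmat-lower-right : ∀ b → (block 𝓜 (lower b) 2F +ₘ block 𝓜 (lower b) 3F) ≈ₘ (θFB +ₘ θFB)
      Mmat-lower-right 0F l l′
        rewrite split₊ 3 1F l | split₊ 2 0F l | split₀ 1 l
              | split₊ 3 1F l′ | split₊ 2 0F l′ | split₀ 1 l′
              | split₊ 3 2F l′ | split₊ 2 1F l′ | split₊ 1 0F l′ | split₀ 0 l′ = ±-cancel (θFB l l′) (K l l′)
      Mmat-lower-right 1F l l′
        rewrite split₊ 3 2F l | split₊ 2 1F l | split₊ 1 0F l | split₀ 0 l
              | split₊ 3 1F l′ | split₊ 2 0F l′ | split₀ 1 l′
              | split₊ 3 2F l′ | split₊ 2 1F l′ | split₊ 1 0F l′ | split₀ 0 l′ = ∓-cancel (θFB l l′) (K l l′)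

      module _ {x y : Vec n} {σ α γ : Carrier} (σσ≈1 : σ * σ ≈ 1#)
        (θFx : (θF ▹ x) ≈ᵥ (α *ᵥ x)) (θGy : (θG ▹ y) ≈ᵥ (γ *ᵥ x))
        (θGtᵀx : ((θGt ᵀ) ▹ x) ≈ᵥ (γ *ᵥ y)) (θFBy : (θFB ▹ y) ≈ᵥ (α *ᵥ y)) {w : Vec (4 *ℕ n)}
        (w-upper : ∀ b l → w (combine (upper b) l) ≈ σ * x l) (w-lower : ∀ b l → w (combine (lower b) l) ≈ y l)
        where

        private
          μ : Carrier
          μ = (α + α) + σ * (γ + γ)

          twice : ∀ (X : Mat n) u l → ((X +ₘ X) ▹ u) l ≈ (X ▹ u) l + (X ▹ u) l
          twice X u = ▹-+ₘ X X u

          upper-row : ∀ b l → (𝓜 ▹ w) (combine (upper b) l) ≈ μ * w (combine (upper b) l)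
          upper-row b l = begin
            (𝓜 ▹ w) (combine (upper b) l)
              ≈⟨ ▹-upper-lower 𝓜 w-upper w-lower (upper b) l ⟩
            ((block 𝓜 (upper b) 0F +ₘ block 𝓜 (upper b) 1F) ▹ (σ *ᵥ x)) l
              + ((block 𝓜 (upper b) 2F +ₘ block 𝓜 (upper b) 3F) ▹ y) l
              ≈⟨ +-cong (trans (▹-congˡ (Mmat-upper-left b) (σ *ᵥ x) l) (twice θF (σ *ᵥ x) l))
                        (trans (▹-congˡ (Mmat-upper-right b) y l) (twice θG y l)) ⟩
            ((θF ▹ (σ *ᵥ x)) l + (θF ▹ (σ *ᵥ x)) l) + ((θG ▹ y) l + (θG ▹ y) l)
              ≈⟨ +-cong (+-cong θFσx θFσx) (+-cong (θGy l) (θGy l)) ⟩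
            (σ * (α * x l) + σ * (α * x l)) + (γ * x l + γ * x l)
              ≈⟨ +-congˡ (+-cong (σσγx≈γx) (σσγx≈γx)) ⟨
            (σ * (α * x l) + σ * (α * x l)) + ((σ * σ) * (γ * x l) + (σ * σ) * (γ * x l))
              ≈⟨ solve 4 (λ s a g v → (s :* (a :* v) :+ s :* (a :* v)) :+ ((s :* s) :* (g :* v) :+ (s :* s) :* (g :* v))
                                      := ((a :+ a) :+ s :* (g :+ g)) :* (s :* v)) refl σ α γ (x l) ⟩
            μ * (σ * x l)
              ≈⟨ *-congˡ (w-upper b l) ⟨
            μ * w (combine (upper b) l)
              ∎
            where
            θFσx : (θF ▹ (σ *ᵥ x)) l ≈ σ * (α * x l)
            θFσx = trans (▹-*ᵥ θF σ x l) (*-congˡ (θFx l))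
            σσγx≈γx : (σ * σ) * (γ * x l) ≈ γ * x l
            σσγx≈γx = trans (*-congʳ σσ≈1) (*-identityˡ (γ * x l))

          lower-row : ∀ b l → (𝓜 ▹ w) (combine (lower b) l) ≈ μ * w (combine (lower b) l)
          lower-row b l = begin
            (𝓜 ▹ w) (combine (lower b) l)
              ≈⟨ ▹-upper-lower 𝓜 w-upper w-lower (lower b) l ⟩
            ((block 𝓜 (lower b) 0F +ₘ block 𝓜 (lower b) 1F) ▹ (σ *ᵥ x)) l
              + ((block 𝓜 (lower b) 2F +ₘ block 𝓜 (lower b) 3F) ▹ y) l
              ≈⟨ +-cong (trans (▹-congˡ (Mmat-lower-left b) (σ *ᵥ x) l) (twice (θGt ᵀ) (σ *ᵥ x) l))
                        (trans (▹-congˡ (Mmat-lower-right b) y l) (twice θFB y l)) ⟩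
            (((θGt ᵀ) ▹ (σ *ᵥ x)) l + ((θGt ᵀ) ▹ (σ *ᵥ x)) l) + ((θFB ▹ y) l + (θFB ▹ y) l)
              ≈⟨ +-cong (+-cong θGtᵀσx θGtᵀσx) (+-cong (θFBy l) (θFBy l)) ⟩
            (σ * (γ * y l) + σ * (γ * y l)) + (α * y l + α * y l)
              ≈⟨ solve 4 (λ s a g v → (s :* (g :* v) :+ s :* (g :* v)) :+ (a :* v :+ a :* v)
                                      := ((a :+ a) :+ s :* (g :+ g)) :* v) refl σ α γ (y l) ⟩
            μ * y l
              ≈⟨ *-congˡ (w-lower b l) ⟨
            μ * w (combine (lower b) l)
              ∎
            where
            θGtᵀσx : ((θGt ᵀ) ▹ (σ *ᵥ x)) l ≈ σ * (γ * y l)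
            θGtᵀσx = trans (▹-*ᵥ (θGt ᵀ) σ x l) (*-congˡ (θGtᵀx l))

        Mmat-eigenvector : (𝓜 ▹ w) ≈ᵥ (((α + α) + σ * (γ + γ)) *ᵥ w)
        Mmat-eigenvector = combine-elim {4} {n} (λ t → (𝓜 ▹ w) t ≈ μ * w t) row
          where
          row : ∀ (b : Fin 4) l → (𝓜 ▹ w) (combine b l) ≈ μ * w (combine b l)
          row 0F = upper-row 0F
          row 1F = upper-row 1F
          row 2F = lower-row 0F
          row 3F = lower-row 1F

    module _ {d : Carrier} {A Bm : Mat n} where
      private
        V : Mat (4 *ℕ n)
        V = Vmat d A Bm

      Vmat-upper : ∀ c b l i → V (combine (upper c) l) (combine (upper b) i) ≈ (sign c * sign b) * (d * A l i)
      Vmat-upper 0F 0F l i rewrite split₀ 3 l | split₀ 3 i =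
        sym (trans (*-congʳ (sign² 0F)) (*-identityˡ (d * A l i)))
      Vmat-upper 0F 1F l i rewrite split₀ 3 l | split₊ 3 0F i | split₀ 2 i =
        sym (trans (*-congʳ (*-identityˡ (- 1#))) (-1*x≈-x (d * A l i)))
      Vmat-upper 1F 0F l i rewrite split₊ 3 0F l | split₀ 2 l | split₀ 3 i =
        sym (trans (*-congʳ (*-identityʳ (- 1#))) (-1*x≈-x (d * A l i)))
      Vmat-upper 1F 1F l i rewrite split₊ 3 0F l | split₀ 2 l | split₊ 3 0F i | split₀ 2 i =
        sym (trans (*-congʳ (sign² 1F)) (*-identityˡ (d * A l i)))

      Vmat-lower : ∀ c b l i → V (combine (lower c) l) (combine (upper b) i) ≈ Bm i l
      Vmat-lower 0F 0F l i rewrite split₊ 3 1F l | split₊ 2 0F l | split₀ 1 l | split₀ 3 i = refl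
      Vmat-lower 0F 1F l i rewrite split₊ 3 1F l | split₊ 2 0F l | split₀ 1 l | split₊ 3 0F i | split₀ 2 i = refl
      Vmat-lower 1F 0F l i rewrite split₊ 3 2F l | split₊ 2 1F l | split₊ 1 0F l | split₀ 0 l | split₀ 3 i = refl
      Vmat-lower 1F 1F l i
        rewrite split₊ 3 2F l | split₊ 2 1F l | split₊ 1 0F l | split₀ 0 l | split₊ 3 0F i | split₀ 2 i = refl

      column-product-upper : ∀ {Vm Ai} → IsSchurInv V Vm → IsSchurInv A Ai → ∀ b b′ i j c l →
        (col V (combine (upper b) i) ∘ᵥ col Vm (combine (upper b′) j)) (combine (upper c) l) ≈
        (sign b * sign b′) * (A l i * Ai l j)
      column-product-upper {Vm} {Ai} V∘Vm A∘Ai b b′ i j c l = begin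
        V (combine (upper c) l) (combine (upper b) i) * Vm (combine (upper c) l) (combine (upper b′) j)
          ≈⟨ scaled-quotient (Vmat-upper c b l i) (Vmat-upper c b′ l j) (V∘Vm _ _) (A∘Ai l j) (sign-pair² c b′) ⟩
        ((sign c * sign b) * (sign c * sign b′)) * (A l i * Ai l j)
          ≈⟨ *-congʳ (trans (interchange (sign c) (sign b) (sign c) (sign b′))
                            (trans (*-congʳ (sign² c)) (*-identityˡ (sign b * sign b′)))) ⟩
        (sign b * sign b′) * (A l i * Ai l j)
          ∎

      column-product-lower : ∀ {Vm B} → IsSchurInv V Vm → IsSchurInv B Bm → ∀ b b′ i j c l →
        (col V (combine (upper b) i) ∘ᵥ col Vm (combine (upper b′) j)) (combine (lower c) l) ≈ Bm i l * B j l
      column-product-lower {Vm} {B} V∘Vm B∘Bm b b′ i j c l = *-cong (Vmat-lower c b l i) (inverse-unique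
        (trans (*-congʳ (sym (Vmat-lower c b′ l j))) (V∘Vm _ _))
        (trans (*-commute (Bm j l) (B j l)) (B∘Bm j l)))

  schur-column-product-nonzero : ∀ {m} {X Y : Mat m} → IsSchurInv X Y →
                                 ∀ r s → ¬ (∀ k → (col X r ∘ᵥ col Y s) k ≈ 0#)
  schur-column-product-nonzero {X = X} {Y} X∘Y r s vanishes = 1≉0 (begin
    1#                               ≈⟨ *-identityˡ 1# ⟨
    1# * 1#                          ≈⟨ *-cong (X∘Y r r) (X∘Y r s) ⟨
    (X r r * Y r r) * (X r s * Y r s) ≈⟨ solve 4 (λ a b p q → (a :* b) :* (p :* q) := (a :* q) :* (b :* p)) refl
                                          (X r r) (Y r r) (X r s) (Y r s) ⟩
    (X r r * Y r s) * (Y r r * X r s) ≈⟨ *-congʳ (vanishes r) ⟩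
    0# * (Y r r * X r s)             ≈⟨ zeroˡ _ ⟩
    0#                               ∎)

lemma7p2 : ∀ {c ℓ} (𝕂 : ACF0 c ℓ) → let open Mats 𝕂 in
    ∀ (n : ℕ) (A B Ai Bm : Mat n) (d : Carrier) →
    IsInvertibleJonesPair A B →
    (A ᵀ) ≈ₘ A →
    IsSchurInv A Ai →
    IsSchurInv B Bm →
    d * d ≈ natC n →
    ∀ (Vm : Mat (4 *ℕ n)) → IsSchurInv (Vmat d A Bm) Vm →
    ∀ (F G H K θF θG θGt θFB θH : Mat n) →
    InN A Ai F →
    InN A B G →
    InN A B H →
    IsΘ A Ai F θF →
    IsΘ A B G θG →
    IsΘ A B (G ᵀ) θGt →
    IsΘ Bm B F θFB →
    InN A (B ᵀ) (K ᵀ) →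
    IsΘ A B H θH →
    IsΘ A (B ᵀ) (K ᵀ) (θH ᵀ) →
    ∀ (r s : Fin (4 *ℕ n)) → toℕ r < 2 *ℕ n → toℕ s < 2 *ℕ n →
    IsEigenvector (Mmat θF H θG θGt θFB K) (col (Vmat d A Bm) r ∘ᵥ col Vm s)
lemma7p2 𝕂 n A B Ai Bm d jones A-sym A∘Ai B∘Bm _ Vm V∘Vm F G H K θF θG θGt θFB _ _ _ _
         θF-def θG-def θGt-def θFB-def _ _ _ r s r<2n s<2n
  with upper-surjective {n} r r<2n | upper-surjective {n} s s<2n
... | b , i , ≡.refl | b′ , j , ≡.refl =
  schur-column-product-nonzero V∘Vm _ _ ,
  _ , Mmat-eigenvector θF H θG θGt θFB K (sign-pair² b b′)
        (θF-eigen θF-def) (θG-eigen θG-def) (θGᵀ-eigen θGt-def) (θFB-eigen θFB-def)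
        (column-product-upper V∘Vm A∘Ai b b′ i j) (column-product-lower V∘Vm B∘Bm b b′ i j)
  where
  open Theory 𝕂
  typeII : IsTypeII A Ai × IsTypeII B Bm
  typeII = invertibleJonesPair⇒typeII jones A-sym A∘Ai B∘Bm
  open ColumnProducts A-sym A∘Ai B∘Bm (proj₁ typeII) (proj₂ typeII) i j
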